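{- For every block graph $G$, $\chi_{\mathrm{gp}}(G)=\left\lceil \frac{\operatorname{diam}(G)+1}{2}\right\rceil$.
   Context: A block graph is a connected graph in which every block (maximal 2-connected subgraph or bridge) is a clique. A set $S$ of vertices of a graph is in general position if no shortest path of the graph contains more than two vertices of $S$. $\chi_{\mathrm{gp}}(G)$ denotes the smallest number of colours in a colouring of $V(G)$ in which every colour class is in general position. $\operatorname{diam}(G)$ is the diameter. -}

module Defs where

open import Level using (0ℓ)
open import Data.Nat using (ℕ; zero; suc; _≤_; ⌈_/2⌉)
open import Data.Fin using (Fin)
open import Data.List using (List; []; _∷_)
open import Data.List.Membership.Propositional using () renaming (_∈_ to _∈L_)
open import Data.Product using (Σ; ∃; _×_; _,_)
open import Relation.Unary using (Pred; _∈_; _⊆_)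
open import Relation.Binary using (Decidable)
open import Relation.Binary.PropositionalEquality using (_≡_; _≢_)
open import Relation.Nullary using (¬_)
open import Data.Empty using (⊥)

record Graph (n : ℕ) : Set₁ where
  field
    Adj    : Fin n → Fin n → Set
    adj?   : Decidable Adj
    sym    : ∀ {u v} → Adj u v → Adj v u
    irrefl : ∀ {u} → ¬ Adj u u

module _ {n : ℕ} (G : Graph n) where
  open Graph G

  data Walk : Fin n → Fin n → Set where
    [_] : (u : Fin n) → Walk u u
    _∷_ : {v w : Fin n} (u : Fin n) → Adj u v → Walk v w → Walk u w

  walkLength : ∀ {u v} → Walk u v → ℕ
  walkLength [ u ]       = zero
  walkLength (_∷_ u _ p) = suc (walkLength p)

  walkVertices : ∀ {u v} → Walk u v → List (Fin n)
  walkVertices [ u ]       = u ∷ []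
  walkVertices (_∷_ u _ p) = u ∷ walkVertices p

  WalkIn : ∀ {u v} → Pred (Fin n) 0ℓ → Walk u v → Set
  WalkIn P p = ∀ x → x ∈L walkVertices p → x ∈ P

  Dist : Fin n → Fin n → ℕ → Set
  Dist u v k = (Σ (Walk u v) λ p → walkLength p ≡ k)
             × (∀ (q : Walk u v) → k ≤ walkLength q)

  IsShortest : ∀ {u v} → Walk u v → Set
  IsShortest {u} {v} p = ∀ (q : Walk u v) → walkLength p ≤ walkLength q

  IsDiameter : ℕ → Set
  IsDiameter D = (∃ λ u → ∃ λ v → Dist u v D)
               × (∀ u v k → Dist u v k → k ≤ D)

  Connected : Set
  Connected = ∀ u v → Walk u v

  ConnectedIn : Pred (Fin n) 0ℓ → Set
  ConnectedIn P = ∀ u v → u ∈ P → v ∈ P → Σ (Walk u v) (WalkIn P)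

  -- G[B] is connected and has no cut vertex (2-connected, a bridge, or K1)
  Nonseparable : Pred (Fin n) 0ℓ → Set
  Nonseparable B = ConnectedIn B
                 × (∀ w → w ∈ B → ConnectedIn (λ x → x ∈ B × x ≢ w))

  IsBlock : Pred (Fin n) 0ℓ → Set₁
  IsBlock B = Nonseparable B × (∀ B' → B ⊆ B' → Nonseparable B' → B' ⊆ B)

  IsClique : Pred (Fin n) 0ℓ → Set
  IsClique B = ∀ u v → u ∈ B → v ∈ B → u ≢ v → Adj u v

  IsBlockGraph : Set₁
  IsBlockGraph = Connected × (∀ B → IsBlock B → IsClique B)

  GeneralPosition : Pred (Fin n) 0ℓ → Set
  GeneralPosition S = ∀ u v (p : Walk u v) → IsShortest p →
    ∀ x y z → x ≢ y → y ≢ z → x ≢ z →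
    x ∈ S → y ∈ S → z ∈ S →
    x ∈L walkVertices p → y ∈L walkVertices p → z ∈L walkVertices p → ⊥

  HasGPColouring : ℕ → Set
  HasGPColouring k = Σ (Fin n → Fin k) λ c →
    ∀ (i : Fin k) → GeneralPosition (λ x → c x ≡ i)

  ChiGP : ℕ → Set
  ChiGP k = HasGPColouring k × (∀ m → HasGPColouring m → k ≤ m)

-- Let H = ⌊D/2⌋ and let c be the middle vertex of a diametral path. In a block graph the
-- distance from a root has no weak local maximum along a geodesic. Indeed, no vertex has two
-- neighbours one step closer to the root, and two adjacent vertices at the same distance
-- have a common neighbour one step closer: in both cases shortest paths to the root close up
-- a cycle, and cycles in block graphs are cliques. So along a geodesic the distance from a
-- vertex first falls strictly and then rises strictly. Applied to the diametral path this
-- puts every vertex within ⌈D/2⌉ ≤ H + 1 of c; applied to an arbitrary geodesic it shows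
-- that no three of its vertices are equidistant from c. Hence colouring by the distance from
-- c modulo H + 1 puts every class in general position: the class of c merges c with the
-- vertices at distance H + 1, and c cannot lie between two of those on a geodesic since
-- D < 2H + 2. Conversely every colour class meets the D + 1 vertices of the diametral path
-- at most twice.
module Submission where

open import Defs
open import Level using (0ℓ)
open import Function using (_∘_; case_of_)
open import Data.Nat
open import Data.Nat.Properties
open import Data.Nat.DivMod using (_%_; _mod_; m≤n⇒m%n≡m; n%n≡0)
open import Data.Fin as Fin using (Fin; zero; suc; toℕ; combine)
open import Data.Fin.Properties using (any?; toℕ<n; toℕ-fromℕ<; combine-injective; pigeonhole)
  renaming (_≟_ to _≟ᶠ_)
open import Data.Fin.Subset using (Subset; _⊂_; _⊃_) renaming (_∈_ to _∈ₛ_)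
open import Data.Fin.Subset.Properties using (_∈?_)
open import Data.Fin.Subset.Induction using (Acc; acc; ⊃-wellFounded)
open import Data.List.Membership.Propositional using () renaming (_∈_ to _∈L_)
open import Data.List.Relation.Unary.Any using (here; there)
open import Data.Vec using (tabulate)
open import Data.Vec.Properties using (lookup∘tabulate; lookup⇒[]=; []=⇒lookup)
open import Data.Product using (Σ; ∃; _×_; _,_; proj₁; proj₂)
open import Data.Sum using (_⊎_; inj₁; inj₂)
open import Data.Empty using (⊥; ⊥-elim)
open import Relation.Unary using (Pred; Decidable; _∈_; _⊆_; _≐_)
open import Relation.Binary.PropositionalEquality
open import Relation.Binary.Definitions using (tri<; tri≈; tri>)
open import Relation.Nullary using (¬_; Dec; yes; no; does)
open import Relation.Nullary.Decidable using (_×-dec_; dec-true; decidable-stable; ¬¬-excluded-middle)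

∸-split : ∀ {a b c} → a ≤ b → b ≤ c → c ∸ a ≡ (b ∸ a) + (c ∸ b)
∸-split {a} {b} {c} a≤b b≤c = +-cancelˡ-≡ a _ _ (begin
  a + (c ∸ a)               ≡⟨ m+[n∸m]≡n (≤-trans a≤b b≤c) ⟩
  c                         ≡⟨ m+[n∸m]≡n b≤c ⟨
  b + (c ∸ b)               ≡⟨ cong (_+ (c ∸ b)) (m+[n∸m]≡n a≤b) ⟨
  a + (b ∸ a) + (c ∸ b)     ≡⟨ +-assoc a _ _ ⟩
  a + ((b ∸ a) + (c ∸ b))   ∎)
  where open ≡-Reasoning

⌈n/2⌉≤1+⌊n/2⌋ : ∀ n → ⌈ n /2⌉ ≤ suc ⌊ n /2⌋
⌈n/2⌉≤1+⌊n/2⌋ zero          = z≤n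
⌈n/2⌉≤1+⌊n/2⌋ (suc zero)    = s≤s z≤n
⌈n/2⌉≤1+⌊n/2⌋ (suc (suc n)) = s≤s (⌈n/2⌉≤1+⌊n/2⌋ n)

⌈n/2⌉≤m : ∀ n m → n ≤ m * 2 → ⌈ n /2⌉ ≤ m
⌈n/2⌉≤m zero          _       _                  = z≤n
⌈n/2⌉≤m (suc n)       zero    ()
⌈n/2⌉≤m 1             (suc m) _                  = s≤s z≤n
⌈n/2⌉≤m (suc (suc n)) (suc m) (s≤s (s≤s n≤2m)) = s≤s (⌈n/2⌉≤m n m n≤2m)

sorted-suffices : (P : ℕ → Set) (L : ℕ) →
  (∀ a b c → a < b → b < c → c ≤ L → P a → P b → P c → ⊥) →
  ∀ a b c → a ≢ b → b ≢ c → a ≢ c → a ≤ L → b ≤ L → c ≤ L → P a → P b → P c → ⊥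
sorted-suffices P L sorted a b c a≢b b≢c a≢c a≤L b≤L c≤L pa pb pc
  with <-cmp a b | <-cmp b c | <-cmp a c
... | tri≈ _ a≡b _ | _            | _            = a≢b a≡b
... | _            | tri≈ _ b≡c _ | _            = b≢c b≡c
... | _            | _            | tri≈ _ a≡c _ = a≢c a≡c
... | tri< a<b _ _ | tri< b<c _ _ | _            = sorted a b c a<b b<c c≤L pa pb pc
... | tri< a<b _ _ | tri> _ _ c<b | tri< a<c _ _ = sorted a c b a<c c<b b≤L pa pc pb
... | tri< a<b _ _ | tri> _ _ c<b | tri> _ _ c<a = sorted c a b c<a a<b b≤L pc pa pb
... | tri> _ _ b<a | tri< b<c _ _ | tri< a<c _ _ = sorted b a c b<a a<c c≤L pb pa pc
... | tri> _ _ b<a | tri< b<c _ _ | tri> _ _ c<a = sorted b c a b<c c<a a≤L pb pc pa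
... | tri> _ _ b<a | tri> _ _ c<b | _            = sorted c b a c<b b<a a≤L pc pb pa

last-agreement : ∀ {n} (P Q : ℕ → Fin n) K → P 0 ≡ Q 0 → P K ≢ Q K →
                ∃ λ j → j < K × P j ≡ Q j × (∀ i → j < i → i ≤ K → P i ≢ Q i)
last-agreement P Q K P0≡Q0 PK≢QK = go K ≤-refl (λ i K<i i≤K → ⊥-elim (<⇒≱ K<i i≤K))
  where
  go : ∀ m → m ≤ K → (∀ i → m < i → i ≤ K → P i ≢ Q i) →
       ∃ λ j → j < K × P j ≡ Q j × (∀ i → j < i → i ≤ K → P i ≢ Q i)
  go m m≤K above with P m ≟ᶠ Q m
  ... | yes Pm≡Qm = m , ≤∧≢⇒< m≤K (λ { refl → PK≢QK Pm≡Qm }) , Pm≡Qm , above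
  go zero    _   _     | no P0≢Q0 = ⊥-elim (P0≢Q0 P0≡Q0)
  go (suc m) m≤K above | no Pm≢Qm = go m (<⇒≤ m≤K) λ i m<i i≤K → case m≤n⇒m<n∨m≡n m<i of λ
    { (inj₁ 1+m<i) → above i 1+m<i i≤K
    ; (inj₂ refl)  → Pm≢Qm }


-- Sequences without a weak peak

descent-or-rise : (f : ℕ → ℕ) → ∀ d a →
                  (∃ λ t → a ≤ t × t < a + d × f t ≤ f (suc t)) ⊎ f (a + d) + d ≤ f a
descent-or-rise f zero    a = inj₂ (≤-reflexive (trans (+-identityʳ _) (cong f (+-identityʳ a))))
descent-or-rise f (suc d) a with f a ≤? f (suc a)
... | yes rise = inj₁ (a , ≤-refl , m<m+n a z<s , rise)
... | no  fall with descent-or-rise f d (suc a)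
...   | inj₁ (t , a<t , t<1+a+d , rise) = inj₁ (t , <⇒≤ a<t , subst (t <_) (sym (+-suc a d)) t<1+a+d , rise)
...   | inj₂ descent = inj₂ (begin
  f (a + suc d) + suc d   ≡⟨ cong (λ z → f z + suc d) (+-suc a d) ⟩
  f (suc a + d) + suc d   ≡⟨ +-suc _ d ⟩
  suc (f (suc a + d) + d) ≤⟨ s≤s descent ⟩
  suc (f (suc a))         ≤⟨ ≰⇒> fall ⟩
  f a                     ∎)
  where open ≤-Reasoning

module NoPeak (f : ℕ → ℕ) (L : ℕ)
              (no-peak : ∀ i → 2 + i ≤ L → f i ≤ f (suc i) → f (2 + i) ≤ f (suc i) → ⊥) where

  module _ {t} (rise : f t ≤ f (suc t)) where

    keeps-rising : ∀ s → t ≤ s → suc s ≤ L → f s ≤ f (suc s)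
    keeps-rising s t≤s s<L with m≤n⇒m<n∨m≡n t≤s
    ... | inj₂ refl = rise
    keeps-rising (suc s) t≤s s<L | inj₁ (s≤s t≤s') with f (suc s) ≤? f (2 + s)
    ...   | yes up = up
    ...   | no  down = ⊥-elim (no-peak s s<L (keeps-rising s t≤s' (<⇒≤ s<L)) (<⇒≤ (≰⇒> down)))

    rises-strictly : ∀ s → t < s → suc s ≤ L → f s < f (suc s)
    rises-strictly (suc s) (s≤s t≤s) s<L with f (suc s) <? f (2 + s)
    ... | yes up   = up
    ... | no  flat = ⊥-elim (no-peak s s<L (keeps-rising s t≤s (<⇒≤ s<L)) (≮⇒≥ flat))

    climbs : ∀ d s → t < s → s + d ≤ L → f s + d ≤ f (s + d)
    climbs zero    s _   _       = ≤-reflexive (trans (+-identityʳ _) (cong f (sym (+-identityʳ s))))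
    climbs (suc d) s t<s s+d≤L = begin
      f s + suc d       ≡⟨ +-suc (f s) d ⟩
      suc (f s + d)     ≤⟨ s≤s (climbs d s t<s (≤-trans (+-monoʳ-≤ s (n≤1+n d)) s+d≤L)) ⟩
      suc (f (s + d))   ≤⟨ rises-strictly (s + d) (<-≤-trans t<s (m≤m+n s d)) (subst (_≤ L) (+-suc s d) s+d≤L) ⟩
      f (suc (s + d))   ≡⟨ cong f (+-suc s d) ⟨
      f (s + suc d)     ∎
      where open ≤-Reasoning

  no-three-equal : ∀ a b c → a < b → b < c → c ≤ L → f a ≡ f b → f b ≡ f c → ⊥
  no-three-equal a b c a<b b<c c≤L fa≡fb fb≡fc with descent-or-rise f (b ∸ a) a
  ... | inj₂ descent = <⇒≢ (begin-strict
    f b                     ≡⟨ cong f (m+[n∸m]≡n (<⇒≤ a<b)) ⟨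
    f (a + (b ∸ a))         <⟨ m<m+n _ (m<n⇒0<n∸m a<b) ⟩
    f (a + (b ∸ a)) + (b ∸ a) ≤⟨ descent ⟩
    f a                     ∎) (sym fa≡fb)
    where open ≤-Reasoning
  ... | inj₁ (t , _ , t<a+[b∸a] , rise) = <⇒≢ (begin-strict
    f b                     <⟨ m<m+n (f b) (m<n⇒0<n∸m b<c) ⟩
    f b + (c ∸ b)           ≤⟨ climbs rise (c ∸ b) b t<b (subst (_≤ L) (sym (m+[n∸m]≡n (<⇒≤ b<c))) c≤L) ⟩
    f (b + (c ∸ b))         ≡⟨ cong f (m+[n∸m]≡n (<⇒≤ b<c)) ⟩
    f c                     ∎) fb≡fc
    where
    open ≤-Reasoning
    t<b : t < b
    t<b = subst (t <_) (m+[n∸m]≡n (<⇒≤ a<b)) t<a+[b∸a]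

  valley : ∀ m → m ≤ L → f m + m ≤ f 0 ⊎ f m + (L ∸ m) ≤ f L
  valley m m≤L with descent-or-rise f m 0
  ... | inj₂ descent = inj₁ descent
  ... | inj₁ (t , _ , t<m , rise) = inj₂ (subst (f m + (L ∸ m) ≤_) (cong f (m+[n∸m]≡n m≤L))
                                          (climbs rise (L ∸ m) m t<m (≤-reflexive (m+[n∸m]≡n m≤L))))

¬¬-decidable : ∀ {n} (P : Pred (Fin n) 0ℓ) → ¬ ¬ Decidable P
¬¬-decidable {zero}  P k = k λ ()
¬¬-decidable {suc n} P k = ¬¬-excluded-middle λ P0? → ¬¬-decidable (P ∘ suc) λ P+? →
  k λ { zero → P0? ; (suc x) → P+? x }

module _ {n : ℕ} where

  toSubset : {P : Pred (Fin n) 0ℓ} → Decidable P → Subset n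
  toSubset P? = tabulate (does ∘ P?)

  module _ {P : Pred (Fin n) 0ℓ} (P? : Decidable P) where

    ∈-toSubset⁺ : ∀ {x} → P x → x ∈ₛ toSubset P?
    ∈-toSubset⁺ {x} px = lookup⇒[]= x _ (trans (lookup∘tabulate _ x) (dec-true (P? x) px))

    ∈-toSubset⁻ : ∀ {x} → x ∈ₛ toSubset P? → P x
    ∈-toSubset⁻ {x} x∈ with P? x | trans (sym (lookup∘tabulate (does ∘ P?) x)) ([]=⇒lookup x∈)
    ... | yes px | _ = px

    toSubset-≐ : P ≐ (_∈ₛ toSubset P?)
    toSubset-≐ = ∈-toSubset⁺ , ∈-toSubset⁻

-- Walks and geodesics

pattern _∷⟨_⟩_ u a p = _∷_ u a p

module Walks {n : ℕ} (G : Graph n) where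
  open Graph G renaming (sym to adj-sym)

  private
    variable
      u v w x : Fin n
      P : Pred (Fin n) 0ℓ

  adj⇒≢ : Adj u v → u ≢ v
  adj⇒≢ a refl = irrefl a

  infixr 5 _++ʷ_

  _++ʷ_ : Walk G u v → Walk G v w → Walk G u w
  [ _ ]         ++ʷ q = q
  (u ∷⟨ a ⟩ p) ++ʷ q = u ∷⟨ a ⟩ (p ++ʷ q)

  walkLength-++ : (p : Walk G u v) (q : Walk G v w) →
                  walkLength G (p ++ʷ q) ≡ walkLength G p + walkLength G q
  walkLength-++ [ _ ]         q = refl
  walkLength-++ (u ∷⟨ a ⟩ p) q = cong suc (walkLength-++ p q)

  ∈-++⁻ : (p : Walk G u v) (q : Walk G v w) → x ∈L walkVertices G (p ++ʷ q) →
          x ∈L walkVertices G p ⊎ x ∈L walkVertices G q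
  ∈-++⁻ [ _ ]         q x∈     = inj₂ x∈
  ∈-++⁻ (u ∷⟨ a ⟩ p) q (here e) = inj₁ (here e)
  ∈-++⁻ (u ∷⟨ a ⟩ p) q (there x∈) with ∈-++⁻ p q x∈
  ... | inj₁ x∈p = inj₁ (there x∈p)
  ... | inj₂ x∈q = inj₂ x∈q

  WalkIn-++ : (p : Walk G u v) (q : Walk G v w) → WalkIn G P p → WalkIn G P q →
              WalkIn G P (p ++ʷ q)
  WalkIn-++ p q p⊆P q⊆P x x∈ with ∈-++⁻ p q x∈
  ... | inj₁ x∈p = p⊆P x x∈p
  ... | inj₂ x∈q = q⊆P x x∈q

  WalkIn-mono : {Q : Pred (Fin n) 0ℓ} → P ⊆ Q → (p : Walk G u v) → WalkIn G P p → WalkIn G Q p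
  WalkIn-mono P⊆Q p p⊆P x x∈ = P⊆Q (p⊆P x x∈)

  WalkIn-edge : (a : Adj u v) → u ∈ P → v ∈ P → WalkIn G P (u ∷⟨ a ⟩ [ v ])
  WalkIn-edge a u∈ v∈ _ (here refl)         = u∈
  WalkIn-edge a u∈ v∈ _ (there (here refl)) = v∈

  head-∈ : (p : Walk G u v) → u ∈L walkVertices G p
  head-∈ [ _ ]         = here refl
  head-∈ (u ∷⟨ a ⟩ p) = here refl

  reverseʷ : Walk G u v → Walk G v u
  reverseʷ [ u ]         = [ u ]
  reverseʷ (u ∷⟨ a ⟩ p) = reverseʷ p ++ʷ (_ ∷⟨ adj-sym a ⟩ [ u ])

  walkLength-reverse : (p : Walk G u v) → walkLength G (reverseʷ p) ≡ walkLength G p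
  walkLength-reverse [ _ ]         = refl
  walkLength-reverse (u ∷⟨ a ⟩ p) = begin
    walkLength G (reverseʷ p ++ʷ (_ ∷⟨ adj-sym a ⟩ [ u ])) ≡⟨ walkLength-++ (reverseʷ p) _ ⟩
    walkLength G (reverseʷ p) + 1                          ≡⟨ +-comm _ 1 ⟩
    suc (walkLength G (reverseʷ p))                        ≡⟨ cong suc (walkLength-reverse p) ⟩
    suc (walkLength G p)                                   ∎
    where open ≡-Reasoning

  ∈-reverse⁻ : (p : Walk G u v) → x ∈L walkVertices G (reverseʷ p) → x ∈L walkVertices G p
  ∈-reverse⁻ [ _ ]         x∈ = x∈
  ∈-reverse⁻ (u ∷⟨ a ⟩ p) x∈ with ∈-++⁻ (reverseʷ p) _ x∈
  ... | inj₁ x∈p            = there (∈-reverse⁻ p x∈p)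
  ... | inj₂ (here refl)    = there (head-∈ p)
  ... | inj₂ (there (here e)) = here e

  WalkIn-reverse : (p : Walk G u v) → WalkIn G P p → WalkIn G P (reverseʷ p)
  WalkIn-reverse p p⊆P x x∈ = p⊆P x (∈-reverse⁻ p x∈)

  ConnectedIn-viaRoot : (r : Fin n) → (∀ x → x ∈ P → Σ (Walk G x r) (WalkIn G P)) →
                        ConnectedIn G P
  ConnectedIn-viaRoot r toRoot u v u∈P v∈P with toRoot u u∈P | toRoot v v∈P
  ... | p , p⊆P | q , q⊆P = p ++ʷ reverseʷ q , WalkIn-++ p (reverseʷ q) p⊆P (WalkIn-reverse q q⊆P)

  Dist-sym : ∀ {k} → Dist G u v k → Dist G v u k
  Dist-sym ((p , |p|≡k) , minimal) =
    (reverseʷ p , trans (walkLength-reverse p) |p|≡k) ,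
    λ q → subst (_ ≤_) (walkLength-reverse q) (minimal (reverseʷ q))

  Dist-functional : ∀ {k l} → Dist G u v k → Dist G u v l → k ≡ l
  Dist-functional ((p , |p|≡k) , k-min) ((q , |q|≡l) , l-min) =
    ≤-antisym (subst (_ ≤_) |q|≡l (k-min q)) (subst (_ ≤_) |p|≡k (l-min p))

  Dist⇒IsShortest : ∀ {k} (d : Dist G u v k) → IsShortest G (proj₁ (proj₁ d))
  Dist⇒IsShortest ((p , |p|≡k) , minimal) q = subst (_≤ walkLength G q) (sym |p|≡k) (minimal q)

  vertexAt : Walk G u v → ℕ → Fin n
  vertexAt [ u ]         _       = u
  vertexAt (u ∷⟨ _ ⟩ _) zero    = u
  vertexAt (_ ∷⟨ _ ⟩ p) (suc i) = vertexAt p i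

  vertexAt-zero : (p : Walk G u v) → vertexAt p 0 ≡ u
  vertexAt-zero [ _ ]         = refl
  vertexAt-zero (_ ∷⟨ _ ⟩ _) = refl

  vertexAt-length : (p : Walk G u v) → vertexAt p (walkLength G p) ≡ v
  vertexAt-length [ _ ]         = refl
  vertexAt-length (_ ∷⟨ _ ⟩ p) = vertexAt-length p

  vertexAt-adjacent : (p : Walk G u v) → ∀ i → i < walkLength G p →
                      Adj (vertexAt p i) (vertexAt p (suc i))
  vertexAt-adjacent (u ∷⟨ a ⟩ p) zero    _         = subst (Adj u) (sym (vertexAt-zero p)) a
  vertexAt-adjacent (_ ∷⟨ _ ⟩ p) (suc i) (s≤s i<) = vertexAt-adjacent p i i<

  vertexAt-∈ : (p : Walk G u v) → ∀ i → i ≤ walkLength G p → vertexAt p i ∈L walkVertices G p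
  vertexAt-∈ [ _ ]         zero    _         = here refl
  vertexAt-∈ (_ ∷⟨ _ ⟩ _) zero    _         = here refl
  vertexAt-∈ (_ ∷⟨ _ ⟩ p) (suc i) (s≤s i≤) = there (vertexAt-∈ p i i≤)

  ∈⇒vertexAt : (p : Walk G u v) → x ∈L walkVertices G p →
               ∃ λ i → i ≤ walkLength G p × vertexAt p i ≡ x
  ∈⇒vertexAt [ _ ]         (here e)   = 0 , z≤n , sym e
  ∈⇒vertexAt (_ ∷⟨ _ ⟩ _) (here e)   = 0 , z≤n , sym e
  ∈⇒vertexAt (_ ∷⟨ _ ⟩ p) (there x∈) with ∈⇒vertexAt p x∈
  ... | i , i≤ , e = suc i , s≤s i≤ , e

  takeʷ : (p : Walk G u v) (i : ℕ) → Walk G u (vertexAt p i)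
  takeʷ [ u ]         _       = [ u ]
  takeʷ (u ∷⟨ _ ⟩ _) zero    = [ u ]
  takeʷ (u ∷⟨ a ⟩ p) (suc i) = u ∷⟨ a ⟩ takeʷ p i

  dropʷ : (p : Walk G u v) (i : ℕ) → Walk G (vertexAt p i) v
  dropʷ [ u ]         _       = [ u ]
  dropʷ (u ∷⟨ a ⟩ p) zero    = u ∷⟨ a ⟩ p
  dropʷ (_ ∷⟨ _ ⟩ p) (suc i) = dropʷ p i

  walkLength-take : (p : Walk G u v) → ∀ i → i ≤ walkLength G p → walkLength G (takeʷ p i) ≡ i
  walkLength-take [ _ ]         zero    _         = refl
  walkLength-take (_ ∷⟨ _ ⟩ _) zero    _         = refl
  walkLength-take (_ ∷⟨ _ ⟩ p) (suc i) (s≤s i≤) = cong suc (walkLength-take p i i≤)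

  walkLength-drop : (p : Walk G u v) → ∀ i → walkLength G (dropʷ p i) ≡ walkLength G p ∸ i
  walkLength-drop [ _ ]         zero    = refl
  walkLength-drop [ _ ]         (suc i) = refl
  walkLength-drop (_ ∷⟨ _ ⟩ _) zero    = refl
  walkLength-drop (_ ∷⟨ _ ⟩ p) (suc i) = walkLength-drop p i

  vertexAt-drop : (p : Walk G u v) → ∀ i k → vertexAt (dropʷ p i) k ≡ vertexAt p (i + k)
  vertexAt-drop [ _ ]         _       _ = refl
  vertexAt-drop (_ ∷⟨ _ ⟩ _) zero    _ = refl
  vertexAt-drop (_ ∷⟨ _ ⟩ p) (suc i) k = vertexAt-drop p i k

  module Geodesic (p : Walk G u v) (p-shortest : IsShortest G p) where

    L : ℕ
    L = walkLength G p

    -- Replacing the segment between positions i and j by a walk q gives a u,v-walk of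
    -- length i + |q| + (L - j), which is at least L.
    Dist-vertexAt : ∀ i j → i ≤ j → j ≤ L → Dist G (vertexAt p i) (vertexAt p j) (j ∸ i)
    Dist-vertexAt i j i≤j j≤L = subst (λ z → Σ (Walk G (vertexAt p i) z) λ q → walkLength G q ≡ j ∸ i)
                                      end≡ (takeʷ (dropʷ p i) (j ∸ i) , |segment|)
                              , minimal
      where
      end≡ : vertexAt (dropʷ p i) (j ∸ i) ≡ vertexAt p j
      end≡ = trans (vertexAt-drop p i (j ∸ i)) (cong (vertexAt p) (m+[n∸m]≡n i≤j))
      |segment| : walkLength G (takeʷ (dropʷ p i) (j ∸ i)) ≡ j ∸ i
      |segment| = walkLength-take (dropʷ p i) (j ∸ i)
                    (subst (j ∸ i ≤_) (sym (walkLength-drop p i)) (∸-monoˡ-≤ i j≤L))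
      minimal : (q : Walk G (vertexAt p i) (vertexAt p j)) → j ∸ i ≤ walkLength G q
      minimal q = m≤n+o⇒m∸n≤o j i (+-cancelʳ-≤ (L ∸ j) j (i + walkLength G q) detour)
        where
        open ≤-Reasoning
        detour : j + (L ∸ j) ≤ i + walkLength G q + (L ∸ j)
        detour = begin
          j + (L ∸ j)  ≡⟨ m+[n∸m]≡n j≤L ⟩
          L            ≤⟨ p-shortest (takeʷ p i ++ʷ q ++ʷ dropʷ p j) ⟩
          walkLength G (takeʷ p i ++ʷ q ++ʷ dropʷ p j)
            ≡⟨ walkLength-++ (takeʷ p i) _ ⟩
          walkLength G (takeʷ p i) + walkLength G (q ++ʷ dropʷ p j)
            ≡⟨ cong₂ _+_ (walkLength-take p i (≤-trans i≤j j≤L)) (walkLength-++ q (dropʷ p j)) ⟩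
          i + (walkLength G q + walkLength G (dropʷ p j))
            ≡⟨ cong (λ z → i + (walkLength G q + z)) (walkLength-drop p j) ⟩
          i + (walkLength G q + (L ∸ j))
            ≡⟨ +-assoc i _ _ ⟨
          i + walkLength G q + (L ∸ j) ∎

    vertexAt-injective≤ : ∀ i j → i ≤ j → j ≤ L → vertexAt p i ≡ vertexAt p j → i ≡ j
    vertexAt-injective≤ i j i≤j j≤L eq
      with subst (λ z → Dist G (vertexAt p i) z (j ∸ i)) (sym eq) (Dist-vertexAt i j i≤j j≤L)
    ... | _ , minimal = ≤-antisym i≤j (m∸n≡0⇒m≤n (n≤0⇒n≡0 (minimal [ vertexAt p i ])))

    vertexAt-injective : ∀ i j → i ≤ L → j ≤ L → vertexAt p i ≡ vertexAt p j → i ≡ j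
    vertexAt-injective i j i≤L j≤L eq with ≤-total i j
    ... | inj₁ i≤j = vertexAt-injective≤ i j i≤j j≤L eq
    ... | inj₂ j≤i = sym (vertexAt-injective≤ j i j≤i i≤L (sym eq))

    no-shortcut : ∀ i → 2 + i ≤ L → ¬ Adj (vertexAt p i) (vertexAt p (2 + i))
    no-shortcut i 2+i≤L a with Dist-vertexAt i (2 + i) (m≤n+m i 2) 2+i≤L
    ... | _ , minimal = 1+n≰n (subst (_≤ 1) (m+n∸n≡m 2 i) (minimal (_ ∷⟨ a ⟩ [ _ ])))

module DepthFrom {n : ℕ} (G : Graph n) (connected : Connected G) (r : Fin n) where
  open Graph G using (Adj; adj?)
  open Walks G

  WalkToRootWithin : ℕ → Fin n → Set
  WalkToRootWithin k x = Σ (Walk G x r) λ p → walkLength G p ≤ k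

  walkToRootWithin? : ∀ k x → Dec (WalkToRootWithin k x)
  walkToRootWithin? k x with x ≟ᶠ r
  ... | yes refl = yes ([ x ] , z≤n)
  walkToRootWithin? zero    x | no x≢r = no λ { ([ _ ] , _) → x≢r refl ; (_ ∷⟨ _ ⟩ _ , ()) }
  walkToRootWithin? (suc k) x | no x≢r with any? (λ y → adj? x y ×-dec walkToRootWithin? k y)
  ... | yes (y , a , p , |p|≤k) = yes (x ∷⟨ a ⟩ p , s≤s |p|≤k)
  ... | no none = no λ { ([ _ ] , _)                → x≢r refl
                       ; (x ∷⟨ a ⟩ p , s≤s |p|≤k) → none (_ , a , p , |p|≤k) }

  shortestWithin : ∀ k x → WalkToRootWithin k x → Σ (Walk G x r) (IsShortest G)
  shortestWithin zero    x (p , |p|≤0) = p , λ q → ≤-trans |p|≤0 z≤n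
  shortestWithin (suc k) x (p , |p|≤1+k) with walkToRootWithin? k x
  ... | yes shorter = shortestWithin k x shorter
  ... | no  none    = p , λ q → ≤-trans |p|≤1+k (≰⇒> λ |q|≤k → none (q , |q|≤k))

  shortestToRoot : ∀ x → Σ (Walk G x r) (IsShortest G)
  shortestToRoot x = shortestWithin _ x (connected x r , ≤-refl)

  depth : Fin n → ℕ
  depth x = walkLength G (proj₁ (shortestToRoot x))

  Dist-depth : ∀ x → Dist G r x (depth x)
  Dist-depth x = Dist-sym ((proj₁ (shortestToRoot x) , refl) , proj₂ (shortestToRoot x))

  depth-unique : ∀ {x k} → Dist G r x k → depth x ≡ k
  depth-unique = Dist-functional (Dist-depth _)

  depth≡0⇒root : ∀ {x} → depth x ≡ 0 → x ≡ r
  depth≡0⇒root {x} = lengthZero (proj₁ (shortestToRoot x))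
    where
    lengthZero : (p : Walk G x r) → walkLength G p ≡ 0 → x ≡ r
    lengthZero [ _ ] _ = refl

  depth-adjacent : ∀ {x y} → Adj x y → depth x ≤ suc (depth y)
  depth-adjacent {x} {y} a = proj₂ (shortestToRoot x) (x ∷⟨ a ⟩ proj₁ (shortestToRoot y))

  record Ray (x : Fin n) : Set where
    field
      at         : ℕ → Fin n
      at-depth   : at (depth x) ≡ x
      at-adjacent : ∀ i → i < depth x → Adj (at i) (at (suc i))
      depth-at   : ∀ i → i ≤ depth x → depth (at i) ≡ i

  ray : ∀ x → Ray x
  ray x = record
    { at          = vertexAt p
    ; at-depth    = subst (λ k → vertexAt p k ≡ x) |p|≡depth (vertexAt-length p)
    ; at-adjacent = λ i i< → vertexAt-adjacent p i (subst (i <_) (sym |p|≡depth) i<)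
    ; depth-at    = λ i i≤ → depth-unique
        (subst (λ z → Dist G z (vertexAt p i) i) (vertexAt-zero p)
               (Dist-vertexAt 0 i z≤n (subst (i ≤_) (sym |p|≡depth) i≤)))
    }
    where
    p : Walk G r x
    p = proj₁ (proj₁ (Dist-depth x))
    |p|≡depth : walkLength G p ≡ depth x
    |p|≡depth = proj₂ (proj₁ (Dist-depth x))
    open Geodesic p (Dist⇒IsShortest (Dist-depth x))

-- Nonseparable sets and cycles in block graphs

module _ {n : ℕ} (G : Graph n) where
  open Graph G renaming (sym to adj-sym)
  open Walks G

  ConnectedIn-≐ : {P Q : Pred (Fin n) 0ℓ} → P ≐ Q → ConnectedIn G P → ConnectedIn G Q
  ConnectedIn-≐ (P⊆Q , Q⊆P) P-conn u v u∈Q v∈Q with P-conn u v (Q⊆P u∈Q) (Q⊆P v∈Q)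
  ... | p , p⊆P = p , WalkIn-mono P⊆Q p p⊆P

  Nonseparable-≐ : {P Q : Pred (Fin n) 0ℓ} → P ≐ Q → Nonseparable G P → Nonseparable G Q
  Nonseparable-≐ (P⊆Q , Q⊆P) (P-conn , P-w-conn) =
    ConnectedIn-≐ (P⊆Q , Q⊆P) P-conn ,
    λ w w∈Q → ConnectedIn-≐ ((λ (x∈ , x≢w) → P⊆Q x∈ , x≢w) , (λ (x∈ , x≢w) → Q⊆P x∈ , x≢w))
                            (P-w-conn w (Q⊆P w∈Q))

  module _ (blockGraph : IsBlockGraph G) where

    -- A nonseparable set S is a block, hence a clique, unless a nonseparable B ⊃ S exists;
    -- then recurse on B. As the goal is negative, B may be assumed decidable.
    nonseparable-¬¬clique : ∀ S → Acc _⊃_ S → Nonseparable G (_∈ₛ S) →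
                            ∀ {u v} → u ∈ₛ S → v ∈ₛ S → u ≢ v → ¬ ¬ Adj u v
    nonseparable-¬¬clique S (acc larger) S-ns {u} {v} u∈ v∈ u≢v ¬uv =
      ¬uv (proj₂ blockGraph (_∈ₛ S) (S-ns , maximal) u v u∈ v∈ u≢v)
      where
      maximal : ∀ B → (_∈ₛ S) ⊆ B → Nonseparable G B → B ⊆ (_∈ₛ S)
      maximal B S⊆B B-ns {x} x∈B with x ∈? S
      ... | yes x∈S = x∈S
      ... | no  x∉S = ⊥-elim (¬¬-decidable B λ B? →
        let S⊂B : S ⊂ toSubset B?
            S⊂B = ∈-toSubset⁺ B? ∘ S⊆B , x , ∈-toSubset⁺ B? x∈B , x∉S
        in nonseparable-¬¬clique (toSubset B?) (larger S⊂B) (Nonseparable-≐ (toSubset-≐ B?) B-ns)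
             (proj₁ S⊂B u∈) (proj₁ S⊂B v∈) u≢v ¬uv)

    nonseparable⇒clique : {C : Pred (Fin n) 0ℓ} → Nonseparable G C → IsClique G C
    nonseparable⇒clique {C} C-ns u v u∈ v∈ u≢v = decidable-stable (adj? u v) λ ¬uv →
      ¬¬-decidable C λ C? →
        nonseparable-¬¬clique (toSubset C?) (⊃-wellFounded _) (Nonseparable-≐ (toSubset-≐ C?) C-ns)
          (∈-toSubset⁺ C? u∈) (∈-toSubset⁺ C? v∈) u≢v ¬uv

  record Cycle : Set where
    field
      len       : ℕ
      vertex    : ℕ → Fin n
      step      : ∀ i → i < len → Adj (vertex i) (vertex (suc i))
      close     : Adj (vertex len) (vertex 0)
      distinct  : ∀ i j → i < j → j ≤ len → vertex i ≢ vertex j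

    vertex-injective : ∀ {i j} → i ≤ len → j ≤ len → i ≢ j → vertex i ≢ vertex j
    vertex-injective {i} {j} i≤len j≤len i≢j with <-cmp i j
    ... | tri< i<j _ _ = distinct i j i<j j≤len
    ... | tri≈ _ i≡j _ = ⊥-elim (i≢j i≡j)
    ... | tri> _ _ j<i = distinct j i j<i i≤len ∘ sym

    Arc : ℕ → ℕ → Pred (Fin n) 0ℓ
    Arc a b x = ∃ λ j → a ≤ j × j ≤ b × vertex j ≡ x

    OnCycle : Pred (Fin n) 0ℓ
    OnCycle = Arc 0 len

    arcDown : ∀ i → i ≤ len → Σ (Walk G (vertex i) (vertex 0)) (WalkIn G (Arc 0 i))
    arcDown zero    _     = [ vertex 0 ] , λ { _ (here refl) → 0 , z≤n , z≤n , refl }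
    arcDown (suc i) 1+i≤ with arcDown i (<⇒≤ 1+i≤)
    ... | p , p⊆arc = vertex (suc i) ∷⟨ adj-sym (step i 1+i≤) ⟩ p ,
      λ { _ (here refl) → suc i , z≤n , ≤-refl , refl
        ; x (there x∈)  → let j , 0≤j , j≤i , e = p⊆arc x x∈ in j , 0≤j , m≤n⇒m≤1+n j≤i , e }

    arcUp : ∀ i → i ≤ len → Σ (Walk G (vertex i) (vertex len)) (WalkIn G (Arc i len))
    arcUp i i≤len = go (len ∸ i) i len (m∸n+n≡m i≤len) ≤-refl
      where
      go : ∀ d i b → d + i ≡ b → b ≤ len → Σ (Walk G (vertex i) (vertex b)) (WalkIn G (Arc i b))
      go zero    i _ refl _ = [ vertex i ] , λ { _ (here refl) → i , ≤-refl , ≤-refl , refl }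
      go (suc d) i _ refl b≤len with go d (suc i) _ (+-suc d i) b≤len
      ... | p , p⊆arc = vertex i ∷⟨ step i (≤-trans (s≤s (m≤n+m i d)) b≤len) ⟩ p ,
        λ { _ (here refl) → i , ≤-refl , m≤n+m i (suc d) , refl
          ; x (there x∈)  → let j , 1+i≤j , j≤b , e = p⊆arc x x∈ in j , <⇒≤ 1+i≤j , j≤b , e }

    arc-avoids : ∀ {a b t} → b ≤ len → t ≤ len → b < t ⊎ t < a →
                 Arc a b ⊆ λ x → OnCycle x × x ≢ vertex t
    arc-avoids {a} {b} {t} b≤len t≤len outside (j , a≤j , j≤b , refl) =
      (j , z≤n , ≤-trans j≤b b≤len , refl) , vertex-injective (≤-trans j≤b b≤len) t≤len j≢t
      where
      j≢t : j ≢ t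
      j≢t refl = notInArc outside
        where
        notInArc : ¬ (b < j ⊎ j < a)
        notInArc (inj₁ b<j) = <⇒≱ b<j j≤b
        notInArc (inj₂ j<a) = <⇒≱ j<a a≤j

    OnCycle-nonseparable : Nonseparable G OnCycle
    OnCycle-nonseparable = connected , connected-without
      where
      connected : ConnectedIn G OnCycle
      connected = ConnectedIn-viaRoot (vertex 0) λ { _ (i , _ , i≤len , refl) →
        let p , p⊆arc = arcDown i i≤len
        in p , WalkIn-mono (λ (j , _ , j≤i , e) → j , z≤n , ≤-trans j≤i i≤len , e) p p⊆arc }

      connected-without : ∀ w → w ∈ OnCycle → ConnectedIn G λ x → OnCycle x × x ≢ w
      connected-without _ (zero , _ , _ , refl) =
        ConnectedIn-viaRoot (vertex len) λ { _ ((i , _ , i≤len , refl) , vi≢v0) →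
          let p , p⊆arc = arcUp i i≤len
          in p , WalkIn-mono (arc-avoids ≤-refl z≤n (inj₂ (0<i i vi≢v0))) p p⊆arc }
        where
        0<i : ∀ i → vertex i ≢ vertex 0 → 0 < i
        0<i zero    ne = ⊥-elim (ne refl)
        0<i (suc i) _  = z<s
      connected-without _ (suc t' , _ , t≤len , refl) =
        ConnectedIn-viaRoot (vertex 0) λ { _ ((i , _ , i≤len , refl) , vi≢vt) → toVertex0 i i≤len vi≢vt }
        where
        t = suc t'
        toVertex0 : ∀ i → i ≤ len → vertex i ≢ vertex t →
                    Σ (Walk G (vertex i) (vertex 0)) (WalkIn G λ x → OnCycle x × x ≢ vertex t)
        toVertex0 i i≤len vi≢vt with <-cmp i t
        ... | tri< i<t _ _ = let p , p⊆arc = arcDown i i≤len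
                             in p , WalkIn-mono (arc-avoids i≤len t≤len (inj₁ i<t)) p p⊆arc
        ... | tri≈ _ refl _ = ⊥-elim (vi≢vt refl)
        ... | tri> _ _ t<i = let p , p⊆arc = arcUp i i≤len
                                 edge = vertex len ∷⟨ close ⟩ [ vertex 0 ]
          in p ++ʷ edge ,
             WalkIn-++ p edge (WalkIn-mono (arc-avoids ≤-refl t≤len (inj₂ t<i)) p p⊆arc)
               (WalkIn-edge close (arc-avoids ≤-refl t≤len (inj₂ (<-≤-trans t<i i≤len)) (len , ≤-refl , ≤-refl , refl))
                                    (arc-avoids z≤n t≤len (inj₁ z<s) (0 , z≤n , z≤n , refl)))

  cycle-clique : IsBlockGraph G → (c : Cycle) → let open Cycle c in
                 ∀ i j → i ≤ len → j ≤ len → i ≢ j → Adj (vertex i) (vertex j)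
  cycle-clique blockGraph c i j i≤len j≤len i≢j =
    nonseparable⇒clique blockGraph OnCycle-nonseparable _ _ (i , z≤n , i≤len , refl) (j , z≤n , j≤len , refl)
      (vertex-injective i≤len j≤len i≢j)
    where open Cycle c

  square-chord : IsBlockGraph G → ∀ {a b c d} → Adj a b → Adj b c → Adj c d → Adj d a →
                 a ≢ c → b ≢ d → Adj a c
  square-chord blockGraph {a} {b} {c} {d} ab bc cd da a≢c b≢d =
    cycle-clique blockGraph square 0 2 z≤n (s≤s (s≤s z≤n)) λ ()
    where
    vertex : ℕ → Fin n
    vertex 0 = a
    vertex 1 = b
    vertex 2 = c
    vertex _ = d

    step : ∀ i → i < 3 → Adj (vertex i) (vertex (suc i))
    step 0 _ = ab
    step 1 _ = bc
    step 2 _ = cd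
    step (suc (suc (suc _))) (s≤s (s≤s (s≤s ())))

    distinct : ∀ i j → i < j → j ≤ 3 → vertex i ≢ vertex j
    distinct 0 1 _ _ = adj⇒≢ ab
    distinct 0 2 _ _ = a≢c
    distinct 0 3 _ _ = adj⇒≢ da ∘ sym
    distinct 1 2 _ _ = adj⇒≢ bc
    distinct 1 3 _ _ = b≢d
    distinct 2 3 _ _ = adj⇒≢ cd
    distinct 1 1 (s≤s ()) _
    distinct (suc (suc _)) 1 (s≤s ()) _
    distinct (suc (suc _)) 2 (s≤s (s≤s ())) _
    distinct (suc (suc (suc _))) 3 (s≤s (s≤s (s≤s ()))) _
    distinct _ (suc (suc (suc (suc _)))) _ (s≤s (s≤s (s≤s ())))

    square : Cycle
    square = record { len = 3 ; vertex = vertex ; step = step ; close = da ; distinct = distinct }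

-- Distance from a root in a block graph

module BlockGraphDepth {n : ℕ} (G : Graph n) (blockGraph : IsBlockGraph G) (r : Fin n) where
  open Graph G renaming (sym to adj-sym)
  open Walks G
  open DepthFrom G (proj₁ blockGraph) r

  record Fork (c α β : ℕ) : Set where
    field
      left right  : ℕ → Fin n
      base        : left 0 ≡ right 0
      left-step   : ∀ i → i < α → Adj (left i) (left (suc i))
      right-step  : ∀ i → i < β → Adj (right i) (right (suc i))
      left-depth  : ∀ i → i ≤ α → depth (left i) ≡ c + i
      right-depth : ∀ i → i ≤ β → depth (right i) ≡ c + i
      apart       : ∀ i → 0 < i → i ≤ β → left i ≢ right i

  -- The two arcs and the edge top form a cycle: depth separates its vertices on each arc,
  -- and apart separates the arcs. The cycle is a clique, so its top reaches its base.
  module _ {c α β} (fork : Fork c α β) (0<β : 0 < β) (β≤α : β ≤ α)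
           (top : Adj (Fork.left fork α) (Fork.right fork β)) where
    open Fork fork

    private
      len : ℕ
      len = α + β

      -- left 0, ..., left α, then right β, ..., right 1
      vertex : ℕ → Fin n
      vertex i with i ≤? α
      ... | yes _ = left i
      ... | no  _ = right (suc len ∸ i)

      vertex-left : ∀ {i} → i ≤ α → vertex i ≡ left i
      vertex-left {i} i≤α with i ≤? α
      ... | yes _   = refl
      ... | no  i≰α = ⊥-elim (i≰α i≤α)

      vertex-right : ∀ {i} → α < i → vertex i ≡ right (suc len ∸ i)
      vertex-right {i} α<i with i ≤? α
      ... | yes i≤α = ⊥-elim (<⇒≱ α<i i≤α)
      ... | no  _   = refl

      data Position (i : ℕ) : Set where
        onLeft  : i ≤ α → vertex i ≡ left i → Position i
        onRight : ∀ k → 0 < k → k ≤ β → i + k ≡ suc len → vertex i ≡ right k → Position i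

      position : ∀ i → i ≤ len → Position i
      position i i≤len with i ≤? α
      ... | yes i≤α = onLeft i≤α (vertex-left i≤α)
      ... | no  i≰α = onRight (suc len ∸ i) (m<n⇒0<n∸m (s≤s i≤len))
                        (subst (suc len ∸ i ≤_) (m+n∸m≡n (suc α) β) (∸-monoʳ-≤ (suc len) (≰⇒> i≰α)))
                        (m+[n∸m]≡n (m≤n⇒m≤1+n i≤len)) (vertex-right (≰⇒> i≰α))

      onRight⇒α<i : ∀ {i k} → k ≤ β → i + k ≡ suc len → α < i
      onRight⇒α<i {i} {k} k≤β i+k≡ = +-cancelʳ-≤ k (suc α) i (begin
        suc α + k ≤⟨ +-monoʳ-≤ (suc α) k≤β ⟩
        suc len   ≡⟨ i+k≡ ⟨
        i + k     ∎)
        where open ≤-Reasoning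

      step : ∀ i → i < len → Adj (vertex i) (vertex (suc i))
      step i i<len with position i (<⇒≤ i<len) | position (suc i) i<len
      ... | onLeft _ vi≡ | onLeft 1+i≤α vi+1≡ = subst₂ Adj (sym vi≡) (sym vi+1≡) (left-step i 1+i≤α)
      ... | onLeft i≤α vi≡ | onRight k _ k≤β i+1+k≡ vi+1≡
        with ≤-antisym i≤α (≤-pred (onRight⇒α<i k≤β i+1+k≡))
      ...   | refl = subst₂ Adj (sym vi≡) (trans (cong right k≡β) (sym vi+1≡)) top
        where
        k≡β : β ≡ k
        k≡β = +-cancelˡ-≡ α β k (sym (suc-injective i+1+k≡))
      step i i<len | onRight _ _ k≤β i+k≡ _ | onLeft 1+i≤α _ =
        ⊥-elim (<⇒≱ (onRight⇒α<i k≤β i+k≡) (<⇒≤ 1+i≤α))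
      step i i<len | onRight k _ k≤β i+k≡ vi≡ | onRight k' _ _ i+1+k'≡ vi+1≡ =
        subst₂ Adj (trans (cong right k≡1+k') (sym vi≡)) (sym vi+1≡)
          (adj-sym (right-step k' (subst (_≤ β) (sym k≡1+k') k≤β)))
        where
        k≡1+k' : suc k' ≡ k
        k≡1+k' = +-cancelˡ-≡ i (suc k') k (trans (+-suc i k') (trans i+1+k'≡ (sym i+k≡)))

      close : Adj (vertex len) (vertex 0)
      close with position len ≤-refl
      ... | onLeft len≤α _ = ⊥-elim (<⇒≱ (m<m+n α 0<β) len≤α)
      ... | onRight k _ _ len+k≡ vlen≡ =
        subst₂ Adj (trans (cong right k≡1) (sym vlen≡)) (trans (sym base) (sym (vertex-left z≤n)))
          (adj-sym (right-step 0 0<β))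
        where
        k≡1 : 1 ≡ k
        k≡1 = +-cancelˡ-≡ len 1 k (trans (+-comm len 1) (sym len+k≡))

      sameDepth : ∀ {x y a b} → depth x ≡ c + a → depth y ≡ c + b → x ≡ y → a ≡ b
      sameDepth dx dy refl = +-cancelˡ-≡ c _ _ (trans (sym dx) dy)

      distinct : ∀ i j → i < j → j ≤ len → vertex i ≢ vertex j
      distinct i j i<j j≤len vi≡vj with position i (≤-trans (<⇒≤ i<j) j≤len) | position j j≤len
      ... | onLeft i≤α vi≡ | onLeft j≤α vj≡ =
        <⇒≢ i<j (sameDepth (left-depth i i≤α) (left-depth j j≤α) (trans (sym vi≡) (trans vi≡vj vj≡)))
      ... | onLeft i≤α vi≡ | onRight k 0<k k≤β _ vj≡ =
        apart k 0<k k≤β (subst (λ z → left z ≡ right k) i≡k (trans (sym vi≡) (trans vi≡vj vj≡)))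
        where
        i≡k : i ≡ k
        i≡k = sameDepth (left-depth i i≤α) (right-depth k k≤β) (trans (sym vi≡) (trans vi≡vj vj≡))
      ... | onRight _ _ k≤β i+k≡ _ | onLeft j≤α _ =
        <⇒≱ (<-trans (onRight⇒α<i k≤β i+k≡) i<j) j≤α
      ... | onRight k _ k≤β i+k≡ vi≡ | onRight k' _ k'≤β j+k'≡ vj≡ =
        <⇒≢ i<j (+-cancelʳ-≡ k i j (trans i+k≡ (trans (sym j+k'≡) (cong (j +_) (sym k≡k')))))
        where
        k≡k' : k ≡ k'
        k≡k' = sameDepth (right-depth k k≤β) (right-depth k' k'≤β) (trans (sym vi≡) (trans vi≡vj vj≡))

      cycle : Cycle G
      cycle = record { len = len ; vertex = vertex ; step = step ; close = close ; distinct = distinct }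

    fork-top-adjacent-base : Adj (left α) (left 0)
    fork-top-adjacent-base = subst₂ Adj (vertex-left ≤-refl) (vertex-left z≤n)
      (cycle-clique G blockGraph cycle α 0 (m≤m+n α β) z≤n (<⇒≢ (<-≤-trans 0<β β≤α) ∘ sym))

    fork-height≤1 : α ≤ 1
    fork-height≤1 = +-cancelˡ-≤ c α 1 (begin
      c + α                ≡⟨ left-depth α ≤-refl ⟨
      depth (left α)       ≤⟨ depth-adjacent fork-top-adjacent-base ⟩
      suc (depth (left 0)) ≡⟨ cong suc (left-depth 0 z≤n) ⟩
      suc (c + 0)          ≡⟨ +-suc c 0 ⟨
      c + 1                ∎)
      where open ≤-Reasoning

  module _ {c α β} (fork : Fork c α β) (β≤α : β ≤ α) {w} (edge : Adj (Fork.left fork α) w)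
           (depth-w : depth w ≡ c + suc α) where
    open Fork fork

    private
      left' : ℕ → Fin n
      left' i with i ≤? α
      ... | yes _ = left i
      ... | no  _ = w

      left'-below : ∀ {i} → i ≤ α → left' i ≡ left i
      left'-below {i} i≤α with i ≤? α
      ... | yes _   = refl
      ... | no  i≰α = ⊥-elim (i≰α i≤α)

      left'-top : left' (suc α) ≡ w
      left'-top with suc α ≤? α
      ... | yes 1+α≤α = ⊥-elim (1+n≰n 1+α≤α)
      ... | no  _     = refl

    extendLeft : Fork c (suc α) β
    extendLeft = record
      { left        = left'
      ; right       = right
      ; base        = trans (left'-below z≤n) base
      ; left-step   = step'
      ; right-step  = right-step
      ; left-depth  = depth'
      ; right-depth = right-depth
      ; apart       = λ i 0<i i≤β → subst (_≢ right i) (sym (left'-below (≤-trans i≤β β≤α))) (apart i 0<i i≤β)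
      }
      where
      step' : ∀ i → i < suc α → Adj (left' i) (left' (suc i))
      step' i i<1+α with m≤n⇒m<n∨m≡n (≤-pred i<1+α)
      ... | inj₁ i<α = subst₂ Adj (sym (left'-below (<⇒≤ i<α))) (sym (left'-below i<α)) (left-step i i<α)
      ... | inj₂ refl = subst₂ Adj (sym (left'-below ≤-refl)) (sym left'-top) edge
      depth' : ∀ i → i ≤ suc α → depth (left' i) ≡ c + i
      depth' i i≤1+α with m≤n⇒m<n∨m≡n i≤1+α
      ... | inj₁ i<1+α = trans (cong depth (left'-below (≤-pred i<1+α))) (left-depth i (≤-pred i<1+α))
      ... | inj₂ refl  = trans (cong depth left'-top) depth-w

    extendLeft-top : Fork.left extendLeft (suc α) ≡ w
    extendLeft-top = left'-top

  module _ {x} (R : Ray x) (j d : ℕ) (j+d≡ : j + d ≡ depth x) where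
    open Ray R

    private
      j+i≤ : ∀ {i} → i ≤ d → j + i ≤ depth x
      j+i≤ i≤d = subst (_ ≤_) j+d≡ (+-monoʳ-≤ j i≤d)

    ray-upper-step : ∀ i → i < d → Adj (at (j + i)) (at (j + suc i))
    ray-upper-step i i<d = subst (Adj (at (j + i)) ∘ at) (sym (+-suc j i))
                             (at-adjacent (j + i) (subst (_≤ depth x) (+-suc j i) (j+i≤ i<d)))

    ray-upper-depth : ∀ i → i ≤ d → depth (at (j + i)) ≡ j + i
    ray-upper-depth i i≤d = depth-at (j + i) (j+i≤ i≤d)

    ray-upper-end : at (j + d) ≡ x
    ray-upper-end = trans (cong at j+d≡) at-depth

  ForkBetween : Fin n → Fin n → Set
  ForkBetween a b = ∃ λ j → ∃ λ d → 0 < d × j + d ≡ depth a ×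
                    Σ (Fork j d d) λ f → Fork.left f d ≡ a × Fork.right f d ≡ b

  -- The rays to a and b part at their last common vertex. (Kept abstract: unfolding the
  -- proof makes type checking of its uses blow up.)
  abstract
    forkBetween : ∀ {a b} → depth a ≡ depth b → a ≢ b → ForkBetween a b
    forkBetween {a} {b} da≡db a≢b = split (last-agreement P Q (depth a) P0≡Q0 PK≢QK)
      where
      open Ray
      P : ℕ → Fin n
      P = at (ray a)
      Q : ℕ → Fin n
      Q = at (ray b)

      P0≡Q0 : P 0 ≡ Q 0
      P0≡Q0 = trans (depth≡0⇒root (depth-at (ray a) 0 z≤n)) (sym (depth≡0⇒root (depth-at (ray b) 0 z≤n)))

      PK≢QK : P (depth a) ≢ Q (depth a)
      PK≢QK PK≡QK = a≢b (trans (sym (at-depth (ray a)))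
                           (trans PK≡QK (subst (λ k → Q k ≡ b) (sym da≡db) (at-depth (ray b)))))

      split : (∃ λ j → j < depth a × P j ≡ Q j × (∀ i → j < i → i ≤ depth a → P i ≢ Q i)) →
              ForkBetween a b
      split (j , j<K , Pj≡Qj , apart-above) =
        j , d , m<n⇒0<n∸m j<K , j+d≡ ,
        record
          { left        = λ i → P (j + i)
          ; right       = λ i → Q (j + i)
          ; base        = trans (cong P (+-identityʳ j)) (trans Pj≡Qj (cong Q (sym (+-identityʳ j))))
          ; left-step   = ray-upper-step (ray a) j d j+d≡
          ; right-step  = ray-upper-step (ray b) j d j+d≡'
          ; left-depth  = ray-upper-depth (ray a) j d j+d≡
          ; right-depth = ray-upper-depth (ray b) j d j+d≡'
          ; apart       = λ i 0<i i≤d → apart-above (j + i) (m<m+n j 0<i) (subst (_ ≤_) j+d≡ (+-monoʳ-≤ j i≤d))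
          } ,
        ray-upper-end (ray a) j d j+d≡ , ray-upper-end (ray b) j d j+d≡'
        where
        d : ℕ
        d = depth a ∸ j
        j+d≡ : j + d ≡ depth a
        j+d≡ = m+[n∸m]≡n (<⇒≤ j<K)
        j+d≡' : j + d ≡ depth b
        j+d≡' = trans j+d≡ da≡db

  -- Otherwise the rays to a and b, with the left one extended by w, form a fork of height
  -- at least 2 closed by the edge w b.
  parent-unique : ∀ {w a b} → Adj w a → Adj w b → a ≢ b → depth a ≡ depth b →
                  depth w ≡ suc (depth a) → ⊥
  parent-unique {w} {a} {b} wa wb a≢b da≡db dw with forkBetween da≡db a≢b
  ... | j , d , 0<d , j+d≡ , f , left-end , right-end =
    <⇒≱ 0<d (≤-pred (fork-height≤1 f⁺ 0<d (n≤1+n d) top))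
    where
    edge : Adj (Fork.left f d) w
    edge = subst (λ z → Adj z w) (sym left-end) (adj-sym wa)
    depth-w : depth w ≡ j + suc d
    depth-w = trans dw (trans (cong suc (sym j+d≡)) (sym (+-suc j d)))
    f⁺ : Fork j (suc d) d
    f⁺ = extendLeft f ≤-refl edge depth-w
    top : Adj (Fork.left f⁺ (suc d)) (Fork.right f⁺ d)
    top = subst₂ Adj (sym (extendLeft-top f ≤-refl edge depth-w)) (sym right-end) wb

  -- The rays to a and b form a fork closed by the edge a b, so it has height 1.
  common-parent : ∀ {a b} → Adj a b → depth a ≡ depth b →
                  ∃ λ p → Adj p a × Adj p b × suc (depth p) ≡ depth a
  common-parent {a} {b} ab da≡db with forkBetween da≡db (adj⇒≢ ab)
  ... | j , d , 0<d , j+d≡ , f , left-end , right-end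
    with ≤-antisym (fork-height≤1 f 0<d ≤-refl (subst₂ Adj (sym left-end) (sym right-end) ab)) 0<d
  ... | refl = left 0 ,
               subst (Adj (left 0)) left-end (left-step 0 0<d) ,
               subst₂ Adj (sym base) right-end (right-step 0 0<d) ,
               trans (cong suc (left-depth 0 z≤n)) (trans (sym (+-suc j 0)) j+d≡)
    where open Fork f

  private
    depth-up : ∀ {x y} → Adj x y → depth x ≤ depth y → depth x ≡ depth y ⊎ suc (depth x) ≡ depth y
    depth-up {x} {y} xy dx≤dy with m≤n⇒m<n∨m≡n dx≤dy
    ... | inj₂ dx≡dy = inj₁ dx≡dy
    ... | inj₁ dx<dy = inj₂ (≤-antisym dx<dy (depth-adjacent (adj-sym xy)))

    parent≢ : ∀ {x y} → suc (depth x) ≡ depth y → x ≢ y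
    parent≢ sdx≡dy refl = 1+n≢n sdx≡dy

    parent-adjacent-to-sibling : ∀ {a b e} → Adj a b → Adj b e →
                                 suc (depth a) ≡ depth b → depth e ≡ depth b → Adj a e
    parent-adjacent-to-sibling {a} {b} {e} ab be sda≡db de≡db with common-parent be (sym de≡db)
    ... | p , pb , pe , sdp≡db with p ≟ᶠ a
    ...   | yes refl = pe
    ...   | no  p≢a  = ⊥-elim (parent-unique (adj-sym ab) (adj-sym pb) (p≢a ∘ sym)
                                 (suc-injective (trans sda≡db (sym sdp≡db))) (sym sda≡db))

  no-local-maximum : ∀ {a b e} → Adj a b → Adj b e → a ≢ e → ¬ Adj a e →
                     depth a ≤ depth b → depth e ≤ depth b → ⊥
  no-local-maximum {a} {b} {e} ab be a≢e ¬ae da≤db de≤db with depth-up ab da≤db | depth-up (adj-sym be) de≤db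
  ... | inj₂ sda≡db | inj₂ sde≡db =
    parent-unique (adj-sym ab) be a≢e (suc-injective (trans sda≡db (sym sde≡db))) (sym sda≡db)
  ... | inj₂ sda≡db | inj₁ de≡db = ¬ae (parent-adjacent-to-sibling ab be sda≡db de≡db)
  ... | inj₁ da≡db  | inj₂ sde≡db =
    ¬ae (adj-sym (parent-adjacent-to-sibling (adj-sym be) (adj-sym ab) sde≡db da≡db))
  ... | inj₁ da≡db  | inj₁ de≡db with common-parent ab da≡db | common-parent be (sym de≡db)
  ...   | p , pa , pb , sdp≡da | q , qb , qe , sdq≡db with p ≟ᶠ q
  ...     | yes refl = ¬ae (square-chord G blockGraph ab be (adj-sym qe) pa a≢e
                              (parent≢ (trans sdp≡da da≡db) ∘ sym))
  ...     | no  p≢q  = parent-unique (adj-sym pb) (adj-sym qb) p≢q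
                         (suc-injective (trans sdp≡da (trans da≡db (sym sdq≡db))))
                         (sym (trans sdp≡da da≡db))

module _ {n : ℕ} (G : Graph n) where
  open Walks G

  -- Tag each position of the geodesic by its colour and by whether that colour already
  -- occurred earlier; the tags are distinct since no colour occurs three times.
  geodesic-size≤2χ : ∀ {m u v} → HasGPColouring G m → (p : Walk G u v) → IsShortest G p →
                     suc (walkLength G p) ≤ m * 2
  geodesic-size≤2χ {m} (colour , gp) p p-shortest with suc (walkLength G p) ≤? m * 2
  ... | yes fits = fits
  ... | no  ¬fits = ⊥-elim (collision (pigeonhole (≰⇒> ¬fits) tag))
    where
    open Geodesic p p-shortest

    colourAt : ℕ → Fin m
    colourAt i = colour (vertexAt p i)

    Repeated : Fin (suc L) → Set
    Repeated k = ∃ λ (j : Fin (toℕ k)) → colourAt (toℕ j) ≡ colourAt (toℕ k)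

    repeated? : ∀ k → Dec (Repeated k)
    repeated? k = any? λ j → colourAt (toℕ j) ≟ᶠ colourAt (toℕ k)

    bit : ∀ {A : Set} → Dec A → Fin 2
    bit (yes _) = suc zero
    bit (no  _) = zero

    tag : Fin (suc L) → Fin (m * 2)
    tag k = combine (colourAt (toℕ k)) (bit (repeated? k))

    collision : (∃ λ i → ∃ λ j → i Fin.< j × tag i ≡ tag j) → ⊥
    collision (i , j , i<j , tagᵢ≡tagⱼ) = bits-differ (repeated? i) (repeated? j) same-bit
      where
      same-colour-and-bit : colourAt (toℕ i) ≡ colourAt (toℕ j) × bit (repeated? i) ≡ bit (repeated? j)
      same-colour-and-bit = combine-injective (colourAt (toℕ i)) _ (colourAt (toℕ j)) _ tagᵢ≡tagⱼ
      same-colour = proj₁ same-colour-and-bit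
      same-bit    = proj₂ same-colour-and-bit

      j≤L : toℕ j ≤ L
      j≤L = ≤-pred (toℕ<n j)

      ≢-position : ∀ {a b} → a ≤ L → b ≤ L → a ≢ b → vertexAt p a ≢ vertexAt p b
      ≢-position a≤L b≤L a≢b e = a≢b (vertexAt-injective _ _ a≤L b≤L e)

      bits-differ : (ri : Dec (Repeated i)) (rj : Dec (Repeated j)) → bit ri ≡ bit rj → ⊥
      bits-differ _        (no ¬rj) _ = ¬rj (Fin.fromℕ< i<j , subst (λ a → colourAt a ≡ _) (sym (toℕ-fromℕ< i<j)) same-colour)
      bits-differ (no _)   (yes _)  ()
      bits-differ (yes (e , same)) (yes _) _ =
        gp (colourAt (toℕ j)) _ _ p p-shortest (vertexAt p (toℕ e)) (vertexAt p (toℕ i)) (vertexAt p (toℕ j))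
          (≢-position e≤L i≤L (<⇒≢ (toℕ<n e))) (≢-position i≤L j≤L (<⇒≢ i<j))
          (≢-position e≤L j≤L (<⇒≢ (<-trans (toℕ<n e) i<j)))
          (trans same same-colour) same-colour refl
          (vertexAt-∈ p _ e≤L) (vertexAt-∈ p _ i≤L) (vertexAt-∈ p _ j≤L)
        where
        i≤L = ≤-trans (<⇒≤ i<j) j≤L
        e≤L = ≤-trans (<⇒≤ (toℕ<n e)) i≤L

-- The colouring by distance from the centre

module _ {n : ℕ} (G : Graph n) (blockGraph : IsBlockGraph G) where
  open Walks G

  connected : Connected G
  connected = proj₁ blockGraph

  module GeodesicDepth {u v} (p : Walk G u v) (p-shortest : IsShortest G p) (r : Fin n) where
    open Geodesic p p-shortest public
    open DepthFrom G connected r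
    open BlockGraphDepth G blockGraph r

    depthAt : ℕ → ℕ
    depthAt i = depth (vertexAt p i)

    no-peak : ∀ i → 2 + i ≤ L → depthAt i ≤ depthAt (suc i) → depthAt (2 + i) ≤ depthAt (suc i) → ⊥
    no-peak i 2+i≤L =
      no-local-maximum (vertexAt-adjacent p i (<⇒≤ 2+i≤L)) (vertexAt-adjacent p (suc i) 2+i≤L)
        (λ e → <⇒≢ (m<n+m i z<s) (vertexAt-injective i (2 + i) (≤-trans (m≤n+m i 2) 2+i≤L) 2+i≤L e))
        (no-shortcut i 2+i≤L)

    open NoPeak depthAt L no-peak public

    depthAt-after : ∀ {s t} → vertexAt p s ≡ r → s ≤ t → t ≤ L → depthAt t ≡ t ∸ s
    depthAt-after {s} {t} ps≡r s≤t t≤L =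
      depth-unique (subst (λ z → Dist G z (vertexAt p t) (t ∸ s)) ps≡r (Dist-vertexAt s t s≤t t≤L))

    depthAt-before : ∀ {s t} → vertexAt p t ≡ r → s ≤ t → t ≤ L → depthAt s ≡ t ∸ s
    depthAt-before {s} {t} pt≡r s≤t t≤L =
      depth-unique (Dist-sym (subst (λ z → Dist G (vertexAt p s) z (t ∸ s)) pt≡r (Dist-vertexAt s t s≤t t≤L)))

  module Diametral (D : ℕ) (diameter : IsDiameter G D) where

    H : ℕ
    H = ⌊ D /2⌋

    u₀ v₀ : Fin n
    u₀ = proj₁ (proj₁ diameter)
    v₀ = proj₁ (proj₂ (proj₁ diameter))

    diametral : Dist G u₀ v₀ D
    diametral = proj₂ (proj₂ (proj₁ diameter))

    Dist≤D : ∀ {x y k} → Dist G x y k → k ≤ D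
    Dist≤D = proj₂ diameter _ _ _

    p₀ : Walk G u₀ v₀
    p₀ = proj₁ (proj₁ diametral)

    |p₀|≡D : walkLength G p₀ ≡ D
    |p₀|≡D = proj₂ (proj₁ diametral)

    p₀-shortest : IsShortest G p₀
    p₀-shortest = Dist⇒IsShortest diametral

    D∸H≡⌈D/2⌉ : D ∸ H ≡ ⌈ D /2⌉
    D∸H≡⌈D/2⌉ = trans (cong (_∸ H) (sym (⌊n/2⌋+⌈n/2⌉≡n D))) (m+n∸m≡n H _)

    centre : Fin n
    centre = vertexAt p₀ H

    open DepthFrom G connected centre

    -- The distances from x along the diametral path form a valley, so its middle vertex
    -- is within ⌈D/2⌉ of x, as the end points are within D.
    radius : ∀ x → depth x ≤ ⌈ D /2⌉
    radius x = subst (depth x ≤_) D∸H≡⌈D/2⌉ (m+n≤o⇒m≤o∸n (depth x) bound)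
      where
      module X = GeodesicDepth p₀ p₀-shortest x
      module DX = DepthFrom G connected x

      depth≡ : depth x ≡ X.depthAt H
      depth≡ = depth-unique (Dist-sym (DX.Dist-depth centre))

      endpoint≤D : ∀ i → X.depthAt i ≤ D
      endpoint≤D i = Dist≤D (DX.Dist-depth (vertexAt p₀ i))

      H≤L : H ≤ X.L
      H≤L = subst (H ≤_) (sym |p₀|≡D) (⌊n/2⌋≤n D)

      bound : depth x + H ≤ D
      bound with X.valley H H≤L
      ... | inj₁ left = begin
        depth x + H     ≡⟨ cong (_+ H) depth≡ ⟩
        X.depthAt H + H ≤⟨ left ⟩
        X.depthAt 0     ≤⟨ endpoint≤D 0 ⟩
        D               ∎
        where open ≤-Reasoning
      ... | inj₂ right = begin
        depth x + H                    ≤⟨ +-monoʳ-≤ (depth x) (⌊n/2⌋≤⌈n/2⌉ D) ⟩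
        depth x + ⌈ D /2⌉              ≡⟨ cong₂ _+_ depth≡ (sym D∸H≡⌈D/2⌉) ⟩
        X.depthAt H + (D ∸ H)          ≡⟨ cong (λ L → X.depthAt H + (L ∸ H)) |p₀|≡D ⟨
        X.depthAt H + (X.L ∸ H)        ≤⟨ right ⟩
        X.depthAt X.L                  ≤⟨ endpoint≤D X.L ⟩
        D                              ∎
        where open ≤-Reasoning

    D<2+2H : D < suc H + suc H
    D<2+2H = begin-strict
      D               ≡⟨ ⌊n/2⌋+⌈n/2⌉≡n D ⟨
      H + ⌈ D /2⌉     ≤⟨ +-monoʳ-≤ H (⌈n/2⌉≤1+⌊n/2⌋ D) ⟩
      H + suc H       <⟨ ≤-refl ⟩
      suc H + suc H   ∎
      where open ≤-Reasoning

    -- Every depth is at most H + 1, so reducing it modulo H + 1 only merges the centre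
    -- with the vertices of depth H + 1.
    colour : Fin n → Fin (suc H)
    colour x = depth x mod suc H

    private
      depth≤1+H : ∀ x → depth x ≤ suc H
      depth≤1+H x = ≤-trans (radius x) (⌈n/2⌉≤1+⌊n/2⌋ D)

      toℕ-colour : ∀ x → toℕ (colour x) ≡ depth x % suc H
      toℕ-colour x = toℕ-fromℕ< _

    colour-suc : ∀ {x j} → colour x ≡ suc j → depth x ≡ suc (toℕ j)
    colour-suc {x} cx with m≤n⇒m<n∨m≡n (depth≤1+H x)
    ... | inj₁ dx≤H   = trans (sym (m≤n⇒m%n≡m (≤-pred dx≤H))) (trans (sym (toℕ-colour x)) (cong toℕ cx))
    ... | inj₂ dx≡1+H with trans (sym (n%n≡0 (suc H)))
                             (trans (cong (_% suc H) (sym dx≡1+H)) (trans (sym (toℕ-colour x)) (cong toℕ cx)))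
    ...   | ()

    Rim : Fin n → Set
    Rim x = x ≡ centre ⊎ depth x ≡ suc H

    colour-zero : ∀ {x} → colour x ≡ zero → Rim x
    colour-zero {x} cx with m≤n⇒m<n∨m≡n (depth≤1+H x)
    ... | inj₁ dx≤H   = inj₁ (depth≡0⇒root
                          (trans (sym (m≤n⇒m%n≡m (≤-pred dx≤H))) (trans (sym (toℕ-colour x)) (cong toℕ cx))))
    ... | inj₂ dx≡1+H = inj₂ dx≡1+H

    module OnGeodesic {u v} (q : Walk G u v) (q-shortest : IsShortest G q) where
      open GeodesicDepth q q-shortest centre

      rim-triple : ∀ a b c → a < b → b < c → c ≤ L →
                   Rim (vertexAt q a) → Rim (vertexAt q b) → Rim (vertexAt q c) → ⊥
      rim-triple a b c a<b b<c c≤L = cases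
        where
        b≤L = ≤-trans (<⇒≤ b<c) c≤L
        a≤L = ≤-trans (<⇒≤ a<b) b≤L
        a≤c = <⇒≤ (<-trans a<b b<c)

        twice : ∀ {s t} → s < t → s ≤ L → t ≤ L → vertexAt q s ≡ centre → vertexAt q t ≡ centre → ⊥
        twice s<t s≤L t≤L qs qt = <⇒≢ s<t (vertexAt-injective _ _ s≤L t≤L (trans qs (sym qt)))

        cases : Rim (vertexAt q a) → Rim (vertexAt q b) → Rim (vertexAt q c) → ⊥
        cases (inj₂ da) (inj₂ db) (inj₂ dc) = no-three-equal a b c a<b b<c c≤L (trans da (sym db)) (trans db (sym dc))
        cases (inj₁ qa) (inj₁ qb) _         = twice a<b a≤L b≤L qa qb
        cases _         (inj₁ qb) (inj₁ qc) = twice b<c b≤L c≤L qb qc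
        cases (inj₁ qa) _         (inj₁ qc) = twice (<-trans a<b b<c) a≤L c≤L qa qc
        cases (inj₁ qa) (inj₂ db) (inj₂ dc) = <⇒≢ b<c (∸-cancelʳ-≡ (<⇒≤ a<b) a≤c (begin
          b ∸ a      ≡⟨ depthAt-after qa (<⇒≤ a<b) b≤L ⟨
          depthAt b  ≡⟨ trans db (sym dc) ⟩
          depthAt c  ≡⟨ depthAt-after qa a≤c c≤L ⟩
          c ∸ a      ∎))
          where open ≡-Reasoning
        cases (inj₂ da) (inj₂ db) (inj₁ qc) = <⇒≢ a<b (∸-cancelˡ-≡ a≤c (<⇒≤ b<c) (begin
          c ∸ a      ≡⟨ depthAt-before qc a≤c c≤L ⟨
          depthAt a  ≡⟨ trans da (sym db) ⟩
          depthAt b  ≡⟨ depthAt-before qc (<⇒≤ b<c) c≤L ⟩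
          c ∸ b      ∎))
          where open ≡-Reasoning
        cases (inj₂ da) (inj₁ qb) (inj₂ dc) = <⇒≱ D<2+2H (begin
          suc H + suc H             ≡⟨ cong₂ _+_ (trans (sym da) (depthAt-before qb (<⇒≤ a<b) b≤L))
                                                 (trans (sym dc) (depthAt-after qb (<⇒≤ b<c) c≤L)) ⟩
          (b ∸ a) + (c ∸ b)         ≡⟨ ∸-split (<⇒≤ a<b) (<⇒≤ b<c) ⟨
          c ∸ a                     ≤⟨ Dist≤D (Dist-vertexAt a c a≤c c≤L) ⟩
          D                         ∎)
          where open ≤-Reasoning

      same-colour-triple : ∀ i a b c → a < b → b < c → c ≤ L →
                           colour (vertexAt q a) ≡ i → colour (vertexAt q b) ≡ i → colour (vertexAt q c) ≡ i → ⊥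
      same-colour-triple zero    a b c a<b b<c c≤L ca cb cc =
        rim-triple a b c a<b b<c c≤L (colour-zero ca) (colour-zero cb) (colour-zero cc)
      same-colour-triple (suc j) a b c a<b b<c c≤L ca cb cc =
        no-three-equal a b c a<b b<c c≤L (trans (colour-suc ca) (sym (colour-suc cb)))
                                         (trans (colour-suc cb) (sym (colour-suc cc)))

    colour-classes-in-general-position : ∀ i → GeneralPosition G (λ x → colour x ≡ i)
    colour-classes-in-general-position i _ _ q q-shortest _ _ _ x≢y y≢z x≢z cx cy cz x∈ y∈ z∈
      with ∈⇒vertexAt q x∈ | ∈⇒vertexAt q y∈ | ∈⇒vertexAt q z∈
    ... | a , a≤L , refl | b , b≤L , refl | c , c≤L , refl =
      sorted-suffices (λ k → colour (vertexAt q k) ≡ i) (walkLength G q)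
        (OnGeodesic.same-colour-triple q q-shortest i) a b c
        (x≢y ∘ cong (vertexAt q)) (y≢z ∘ cong (vertexAt q)) (x≢z ∘ cong (vertexAt q)) a≤L b≤L c≤L cx cy cz

mainTheorem5 : ∀ {n : ℕ} (G : Graph n) → IsBlockGraph G →
    ∀ (D : ℕ) → IsDiameter G D → ChiGP G ⌈ suc D /2⌉
mainTheorem5 G blockGraph D diameter =
  (colour , colour-classes-in-general-position) ,
  λ m χ → ⌈n/2⌉≤m (suc D) m (subst (λ L → suc L ≤ m * 2) |p₀|≡D (geodesic-size≤2χ G χ p₀ p₀-shortest))
  where open Diametral G blockGraph D diameter
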